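{- Let $T$ be a tree on $n\ge 4$ vertices which is a path. Then the graph $H$ returned by the procedure Path_Augmentation applied to $T$ is 3-connected, i.e. has vertex connectivity exactly 3.
   Context: Procedure Path_Augmentation: the input is a tree $T$ that is a path on $n$ vertices, written $v_1, v_2, \ldots, v_n$ with $v_i$ adjacent to $v_{i+1}$ for $1\le i\le n-1$. "Adding" an edge means inserting it into the current graph (initially $T$) and into the output set $E_{ca}$ (initially empty). First add the edge $\{v_1,v_n\}$. Then, for $i=1,2,\ldots,\lceil n/2\rceil$ in this order: if the current degree of $v_i$ equals 2, add the edge $\{v_i, v_{\lfloor n/2\rfloor + i}\}$. Finally, if the current degree of $v_n$ equals 2, add the edge $\{v_n, v_{\lfloor n/2\rfloor+1}\}$. The procedure returns the resulting graph $H$ and the set $E_{ca}$. -}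

module Defs where

open import Data.Nat using (ℕ; zero; suc; _+_; _∸_; _≤_; _<_; _≡ᵇ_; ⌊_/2⌋; ⌈_/2⌉)
open import Data.Bool using (if_then_else_)
open import Data.Product using (_×_; _,_; proj₁; proj₂)
open import Data.Sum using (_⊎_)
open import Data.List using (List; []; _∷_; _++_; map; foldl; upTo; length)
open import Data.Nat.ListAction using (sum)
open import Relation.Nullary using (¬_)
open import Data.List.Membership.Propositional using (_∈_; _∉_)
open import Data.List.Relation.Unary.Unique.Propositional using (Unique)

-- Vertices are labelled by natural numbers 1..n  (label i stands for v_i).
-- A graph on {v_1,…,v_n} is given by a list of edges (unordered pairs
-- written as ordered pairs).
Edge : Set
Edge = ℕ × ℕ

oneTo : ℕ → List ℕ
oneTo m = map suc (upTo m)

pathEdges : ℕ → List Edge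
pathEdges n = map (λ i → (i , suc i)) (oneTo (n ∸ 1))

incid : ℕ → Edge → ℕ
incid v (a , b) = (if a ≡ᵇ v then 1 else 0) + (if b ≡ᵇ v then 1 else 0)

degree : List Edge → ℕ → ℕ
degree E v = sum (map (incid v) E)

addIfDeg2 : List Edge → ℕ → ℕ → List Edge
addIfDeg2 E u w = if degree E u ≡ᵇ 2 then E ++ ((u , w) ∷ []) else E

pathAugmentation : ℕ → List Edge
pathAugmentation n =
  let E₀ = pathEdges n ++ ((1 , n) ∷ [])
      E₁ = foldl (λ E i → addIfDeg2 E i (⌊ n /2⌋ + i)) E₀ (oneTo ⌈ n /2⌉)
  in addIfDeg2 E₁ n (suc ⌊ n /2⌋)

InV : ℕ → ℕ → Set
InV n v = 1 ≤ v × v ≤ n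

Adj : List Edge → ℕ → ℕ → Set
Adj E u v = (u , v) ∈ E ⊎ (v , u) ∈ E

data Reach (n : ℕ) (E : List Edge) (S : List ℕ) : ℕ → ℕ → Set where
  here : ∀ {u} → Reach n E S u u
  step : ∀ {u w v} → Adj E u w → InV n w → w ∉ S →
         Reach n E S w v → Reach n E S u v

ConnectedMinus : ℕ → List Edge → List ℕ → Set
ConnectedMinus n E S =
  ∀ u v → InV n u → InV n v → u ∉ S → v ∉ S → Reach n E S u v

KConnected : ℕ → List Edge → ℕ → Set
KConnected n E k =
  k < n ×
  (∀ (S : List ℕ) → Unique S → (∀ x → x ∈ S → InV n x) →
     length S < k → ConnectedMinus n E S)

-- vertex connectivity κ(G) = the greatest k such that G is k-connected;
-- since k-connectedness is downward closed, κ(G) = k iff G is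
-- k-connected and not (k+1)-connected.
VertexConnectivityIs : ℕ → List Edge → ℕ → Set
VertexConnectivityIs n E k = KConnected n E k × ¬ KConnected n E (suc k)

-- Write m = ⌊n/2⌋ ≥ 2. Path_Augmentation closes the path into the cycle 1, …, n and then adds
-- the chords j – (m + j) for 1 ≤ j ≤ m and, for odd n, the chord n – (m + 1): a vertex still
-- has degree 2 exactly when no chord has reached it yet. Deleting two vertices x ≤ y leaves the
-- arc strictly between them and the rest of the cycle, which stays connected through the edge
-- 1 – n; a short case analysis on x and y finds a chord joining the two parts whenever both are
-- nonempty. Conversely, the three neighbours 2, n and m + 1 of vertex 1 separate it from m + 2.

module Submission where

open import Defs
open import Data.Bool using (if_then_else_)
open import Data.List using (List; []; _∷_; _++_; map; foldl; upTo; [_]; length)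
open import Data.List.Membership.Propositional using (_∈_; _∉_)
open import Data.List.Membership.Propositional.Properties
  using (∈-map⁺; ∈-map⁻; ∈-upTo⁺; ∈-upTo⁻; ∈-++⁺ˡ; ∈-++⁺ʳ; ∈-++⁻)
open import Data.List.Properties using (map-++; ++-assoc; ++-identityʳ; foldl-++; upTo-∷ʳ)
open import Data.List.Relation.Unary.All using (All; []; _∷_)
open import Data.List.Relation.Unary.AllPairs using (AllPairs; []; _∷_)
open import Data.List.Relation.Unary.Any using (here; there)
open import Data.List.Relation.Unary.Unique.Propositional using (Unique)
import Data.List.Relation.Unary.All as All
open import Data.List.Relation.Unary.All.Properties using (All¬⇒¬Any)
import Data.List.Relation.Unary.Unique.Propositional.Properties as Unique
import Data.List.Relation.Unary.AllPairs.Properties as AllPairs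
open import Data.Nat using (ℕ; zero; suc; _+_; _≤_; _<_; s≤s; z≤n; _≟_; _≤?_; _<?_; _≡ᵇ_; ⌊_/2⌋)
open import Data.Nat.ListAction using (sum)
open import Data.Nat.ListAction.Properties using (sum-++)
open import Data.Nat.Properties
open import Algebra.Properties.CommutativeSemigroup +-commutativeSemigroup using (interchange)
open import Data.Product using (_×_; _,_; ∃-syntax; proj₁; proj₂)
open import Data.Sum using (_⊎_; inj₁; inj₂; swap)
open import Function using (_∘_; id)
open import Relation.Binary.PropositionalEquality hiding ([_])
open import Relation.Binary.Definitions using (tri<; tri≈; tri>)
open import Relation.Nullary using (¬_; contradiction; yes; no)
open import Relation.Nullary.Decidable using (dec-true; dec-false)

-- Counting edge ends

-- incid v (a , b) reduces to hits v a + hits v b.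
hits : ℕ → ℕ → ℕ
hits v a = if a ≡ᵇ v then 1 else 0

-- does (a ≟ v) is definitionally a ≡ᵇ v.
hits-≡ : ∀ v → hits v v ≡ 1
hits-≡ v = cong (if_then 1 else 0) (dec-true (v ≟ v) refl)

hits-≢ : ∀ {a v} → a ≢ v → hits v a ≡ 0
hits-≢ {a} {v} a≢v = cong (if_then 1 else 0) (dec-false (a ≟ v) a≢v)

multiplicity : ℕ → List ℕ → ℕ
multiplicity v xs = sum (map (hits v) xs)

multiplicity-∉ : ∀ {v} xs → v ∉ xs → multiplicity v xs ≡ 0
multiplicity-∉ []       v∉xs = refl
multiplicity-∉ (x ∷ xs) v∉xs =
  cong₂ _+_ (hits-≢ (λ x≡v → v∉xs (here (sym x≡v)))) (multiplicity-∉ xs (v∉xs ∘ there))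

multiplicity-∈ : ∀ {v xs} → Unique xs → v ∈ xs → multiplicity v xs ≡ 1
multiplicity-∈ {xs = x ∷ xs} (x∉xs ∷ _) (here refl) =
  cong₂ _+_ (hits-≡ x) (multiplicity-∉ xs (λ x∈xs → All.lookup x∉xs x∈xs refl))
multiplicity-∈ {xs = x ∷ xs} (x∉xs ∷ xs!) (there v∈xs) =
  cong₂ _+_ (hits-≢ (All.lookup x∉xs v∈xs)) (multiplicity-∈ xs! v∈xs)

degree-++ : ∀ E F v → degree (E ++ F) v ≡ degree E v + degree F v
degree-++ E F v = trans (cong sum (map-++ (incid v) E F)) (sum-++ (map (incid v) E) (map (incid v) F))

degree-graph : ∀ (f g : ℕ → ℕ) xs v →
  degree (map (λ i → (f i , g i)) xs) v ≡ multiplicity v (map f xs) + multiplicity v (map g xs)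
degree-graph f g []       v = refl
degree-graph f g (x ∷ xs) v =
  trans (cong (incid v (f x , g x) +_) (degree-graph f g xs v)) (interchange (hits v (f x)) (hits v (g x)) _ _)

∈-oneTo⁺ : ∀ {v k} → 1 ≤ v → v ≤ k → v ∈ oneTo k
∈-oneTo⁺ {suc i} _ i<k = ∈-map⁺ suc (∈-upTo⁺ i<k)

∈-oneTo⁻ : ∀ {v k} → v ∈ oneTo k → 1 ≤ v × v ≤ k
∈-oneTo⁻ v∈ with ∈-map⁻ suc v∈
... | i , i∈ , refl = s≤s z≤n , ∈-upTo⁻ i∈

interval : ℕ → ℕ → List ℕ
interval a k = map (a +_) (oneTo k)

∈-interval⁺ : ∀ {a v k} → a < v → v ≤ a + k → v ∈ interval a k
∈-interval⁺ {a} {k = k} a<v v≤a+k with m≤n⇒∃[o]m+o≡n a<v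
... | o , refl = subst (_∈ interval a k) (+-suc a o)
  (∈-map⁺ (a +_) (∈-oneTo⁺ (s≤s z≤n) (+-cancelˡ-≤ a _ _ (subst (_≤ a + k) (sym (+-suc a o)) v≤a+k))))

∈-interval⁻ : ∀ {a v k} → v ∈ interval a k → a < v × v ≤ a + k
∈-interval⁻ {a} v∈ with ∈-map⁻ (a +_) v∈
... | i , i∈ , refl with ∈-oneTo⁻ i∈
... | 1≤i , i≤k = m<m+n a 1≤i , +-monoʳ-≤ a i≤k

interval-unique : ∀ a k → Unique (interval a k)
interval-unique a k = Unique.map⁺ (+-cancelˡ-≡ a _ _) (Unique.map⁺ suc-injective (Unique.upTo⁺ k))

multiplicity-inside : ∀ a k {v} → a < v → v ≤ a + k → multiplicity v (interval a k) ≡ 1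
multiplicity-inside a k a<v v≤a+k = multiplicity-∈ (interval-unique a k) (∈-interval⁺ a<v v≤a+k)

multiplicity-outside : ∀ a k {v} → v ≤ a ⊎ a + k < v → multiplicity v (interval a k) ≡ 0
multiplicity-outside a k {v} v-outside = multiplicity-∉ (interval a k) (excluded v-outside)
  where
    excluded : v ≤ a ⊎ a + k < v → v ∉ interval a k
    excluded (inj₁ v≤a)   v∈ = <⇒≱ (proj₁ (∈-interval⁻ v∈)) v≤a
    excluded (inj₂ a+k<v) v∈ = <⇒≱ a+k<v (proj₂ (∈-interval⁻ v∈))

cycle : ℕ → List Edge
cycle n = pathEdges n ++ ((1 , n) ∷ [])

degree-cycle : ∀ {n v} → 2 ≤ n → 1 ≤ v → v ≤ n → degree (cycle n) v ≡ 2
degree-cycle {suc k} {v} (s≤s 1≤k) 1≤v v≤n = begin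
  degree (cycle (suc k)) v
    ≡⟨ degree-++ (pathEdges (suc k)) _ v ⟩
  degree (pathEdges (suc k)) v + (incid v (1 , suc k) + 0)
    ≡⟨ cong₂ _+_ (degree-graph (0 +_) (1 +_) (oneTo k) v) (+-identityʳ _) ⟩
  (multiplicity v (interval 0 k) + multiplicity v (interval 1 k)) + (hits v 1 + hits v (suc k))
    ≡⟨ counts v 1≤v (m≤n⇒m<n∨m≡n v≤n) ⟩
  2 ∎
  where
    open ≡-Reasoning
    counts : ∀ v → 1 ≤ v → v < suc k ⊎ v ≡ suc k →
      (multiplicity v (interval 0 k) + multiplicity v (interval 1 k)) + (hits v 1 + hits v (suc k)) ≡ 2
    counts (suc zero) _ _ =
      cong₂ _+_ (cong₂ _+_ (multiplicity-inside 0 k (s≤s z≤n) 1≤k) (multiplicity-outside 1 k (inj₁ ≤-refl)))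
                (cong₂ _+_ (hits-≡ 1) (hits-≢ {suc k} {1} (>⇒≢ (s≤s 1≤k))))
    counts (suc (suc i)) _ (inj₁ (s≤s v≤k)) =
      cong₂ _+_ (cong₂ _+_ (multiplicity-inside 0 k (s≤s z≤n) v≤k)
                           (multiplicity-inside 1 k (s≤s (s≤s z≤n)) (m≤n⇒m≤1+n v≤k)))
                (cong₂ _+_ (hits-≢ {1} {suc (suc i)} λ ()) (hits-≢ {suc k} {suc (suc i)} (>⇒≢ (s≤s v≤k))))
    counts (suc (suc i)) _ (inj₂ refl) =
      cong₂ _+_ (cong₂ _+_ (multiplicity-outside 0 k (inj₂ ≤-refl))
                           (multiplicity-inside 1 k (s≤s (s≤s z≤n)) ≤-refl))
                (cong₂ _+_ (hits-≢ {1} {suc (suc i)} λ ()) (hits-≡ (suc (suc i))))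

chords : ℕ → List ℕ → List Edge
chords m = map (λ i → (i , m + i))

degree-chords-upper : ∀ {m v} → m < v → v ≤ m + m → degree (chords m (oneTo m)) v ≡ 1
degree-chords-upper {m} {v} m<v v≤m+m = trans (degree-graph (0 +_) (m +_) (oneTo m) v)
  (cong₂ _+_ (multiplicity-outside 0 m (inj₂ m<v)) (multiplicity-inside m m m<v v≤m+m))

degree-chords-beyond : ∀ {m v} → m + m < v → degree (chords m (oneTo m)) v ≡ 0
degree-chords-beyond {m} {v} m+m<v = trans (degree-graph (0 +_) (m +_) (oneTo m) v)
  (cong₂ _+_ (multiplicity-outside 0 m (inj₂ (≤-<-trans (m≤m+n m m) m+m<v)))
             (multiplicity-outside m m (inj₂ m+m<v)))

-- The graph returned by Path_Augmentation

addIfDeg2-yes : ∀ E u w → degree E u ≡ 2 → addIfDeg2 E u w ≡ E ++ [ (u , w) ]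
addIfDeg2-yes E u w d = cong (λ d → if d ≡ᵇ 2 then E ++ ((u , w) ∷ []) else E) d

addIfDeg2-no : ∀ E u w → degree E u ≢ 2 → addIfDeg2 E u w ≡ E
addIfDeg2-no E u w d≢2 =
  cong (if_then E ++ ((u , w) ∷ []) else E) (dec-false (degree E u ≟ 2) d≢2)

foldl-addIfDeg2 : ∀ (f : ℕ → ℕ) E is →
  All (λ i → degree E i ≡ 2) is → AllPairs (λ i j → incid j (i , f i) ≡ 0) is →
  foldl (λ E i → addIfDeg2 E i (f i)) E is ≡ E ++ map (λ i → (i , f i)) is
foldl-addIfDeg2 f E []       _          _           = sym (++-identityʳ E)
foldl-addIfDeg2 f E (i ∷ is) (dᵢ ∷ ds) (fresh ∷ ps) = begin
  foldl add (addIfDeg2 E i (f i)) is  ≡⟨ cong (λ F → foldl add F is) (addIfDeg2-yes E i (f i) dᵢ) ⟩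
  foldl add (E ++ [ (i , f i) ]) is    ≡⟨ foldl-addIfDeg2 f _ is ds′ ps ⟩
  (E ++ [ (i , f i) ]) ++ map edge is  ≡⟨ ++-assoc E _ _ ⟩
  E ++ map edge (i ∷ is)               ∎
  where
    open ≡-Reasoning
    add : List Edge → ℕ → List Edge
    add E i = addIfDeg2 E i (f i)
    edge : ℕ → Edge
    edge i = (i , f i)
    ds′ : All (λ j → degree (E ++ [ (i , f i) ]) j ≡ 2) is
    ds′ = All.zipWith (λ {j} (d , z) → trans (degree-++ E _ j) (cong₂ _+_ d (cong (_+ 0) z)))
                      (ds , fresh)

oneTo-∷ʳ : ∀ k → oneTo (suc k) ≡ oneTo k ++ [ suc k ]
oneTo-∷ʳ k = trans (cong (map suc) (sym (upTo-∷ʳ k))) (map-++ suc (upTo k) [ k ])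

cycleWithChords : ℕ → ℕ → List Edge
cycleWithChords n m = cycle n ++ chords m (oneTo m)

chords-added : ∀ {m n} → 1 ≤ m → m + m ≤ n →
  foldl (λ E i → addIfDeg2 E i (m + i)) (cycle n) (oneTo m) ≡ cycleWithChords n m
chords-added {m} {n} 1≤m m+m≤n = foldl-addIfDeg2 (m +_) (cycle n) (oneTo m) on-cycle unaffected
  where
    on-cycle : All (λ i → degree (cycle n) i ≡ 2) (oneTo m)
    on-cycle = All.tabulate λ i∈ →
      degree-cycle (≤-trans (+-mono-≤ 1≤m 1≤m) m+m≤n) (proj₁ (∈-oneTo⁻ i∈))
                   (≤-trans (proj₂ (∈-oneTo⁻ i∈)) (≤-trans (m≤m+n m m) m+m≤n))
    unaffected : AllPairs (λ i j → incid j (i , m + i) ≡ 0) (oneTo m)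
    unaffected = AllPairs.map⁺ (AllPairs.applyUpTo⁺₁ id m λ {i} {j} i<j j<m →
      cong₂ _+_ (hits-≢ {suc i} {suc j} (<⇒≢ (s≤s i<j)))
                (hits-≢ {m + suc i} {suc j} (>⇒≢ (≤-<-trans j<m (m<m+n m (s≤s z≤n))))))

degree-cycleWithChords : ∀ {m n v} → 1 ≤ m → m + m ≤ n → 1 ≤ v → v ≤ n →
  degree (cycleWithChords n m) v ≡ 2 + degree (chords m (oneTo m)) v
degree-cycleWithChords {m} {n} {v} 1≤m m+m≤n 1≤v v≤n =
  trans (degree-++ (cycle n) _ v)
        (cong (_+ degree (chords m (oneTo m)) v)
              (degree-cycle (≤-trans (+-mono-≤ 1≤m 1≤m) m+m≤n) 1≤v v≤n))

-- pathAugmentation n unfolds to augment n ⌊ n /2⌋ ⌈ n /2⌉.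
augment : ℕ → ℕ → ℕ → List Edge
augment n h c = addIfDeg2 (foldl (λ E i → addIfDeg2 E i (h + i)) (cycle n) (oneTo c)) n (suc h)

pathAugmentation-even : ∀ {m} → 1 ≤ m → pathAugmentation (m + m) ≡ cycleWithChords (m + m) m
pathAugmentation-even {m} 1≤m = begin
  pathAugmentation (m + m)
    ≡⟨ cong₂ (augment (m + m)) (sym (n≡⌊n+n/2⌋ m)) (sym (n≡⌈n+n/2⌉ m)) ⟩
  addIfDeg2 (foldl (λ E i → addIfDeg2 E i (m + i)) (cycle (m + m)) (oneTo m)) (m + m) (suc m)
    ≡⟨ cong (λ E → addIfDeg2 E (m + m) (suc m)) (chords-added 1≤m ≤-refl) ⟩
  addIfDeg2 (cycleWithChords (m + m) m) (m + m) (suc m)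
    ≡⟨ addIfDeg2-no _ (m + m) (suc m) (λ d≡2 → 1+n≢n (trans (sym last≡3) d≡2)) ⟩
  cycleWithChords (m + m) m ∎
  where
    open ≡-Reasoning
    last≡3 : degree (cycleWithChords (m + m) m) (m + m) ≡ 3
    last≡3 = trans (degree-cycleWithChords 1≤m ≤-refl (≤-trans 1≤m (m≤m+n m m)) ≤-refl)
                   (cong (2 +_) (degree-chords-upper (m<m+n m 1≤m) ≤-refl))

pathAugmentation-odd : ∀ {m} → 1 ≤ m →
  pathAugmentation (suc (m + m)) ≡ cycleWithChords (suc (m + m)) m ++ [ (suc (m + m) , suc m) ]
pathAugmentation-odd {m} 1≤m = begin
  pathAugmentation n
    ≡⟨ cong₂ (augment n) (sym (n≡⌈n+n/2⌉ m)) (cong suc (sym (n≡⌊n+n/2⌋ m))) ⟩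
  addIfDeg2 (foldl add (cycle n) (oneTo (suc m))) n (suc m)
    ≡⟨ cong (λ is → addIfDeg2 (foldl add (cycle n) is) n (suc m)) (oneTo-∷ʳ m) ⟩
  addIfDeg2 (foldl add (cycle n) (oneTo m ++ [ suc m ])) n (suc m)
    ≡⟨ cong (λ E → addIfDeg2 E n (suc m)) (foldl-++ add (cycle n) (oneTo m) [ suc m ]) ⟩
  addIfDeg2 (add (foldl add (cycle n) (oneTo m)) (suc m)) n (suc m)
    ≡⟨ cong (λ E → addIfDeg2 (add E (suc m)) n (suc m)) (chords-added 1≤m (n≤1+n (m + m))) ⟩
  addIfDeg2 (add (cycleWithChords n m) (suc m)) n (suc m)
    ≡⟨ cong (λ E → addIfDeg2 E n (suc m))
            (addIfDeg2-no (cycleWithChords n m) (suc m) (m + suc m)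
                          (λ d≡2 → 1+n≢n (trans (sym middle≡3) d≡2))) ⟩
  addIfDeg2 (cycleWithChords n m) n (suc m)
    ≡⟨ addIfDeg2-yes _ n (suc m) last≡2 ⟩
  cycleWithChords n m ++ [ (n , suc m) ] ∎
  where
    open ≡-Reasoning
    n : ℕ
    n = suc (m + m)
    add : List Edge → ℕ → List Edge
    add E i = addIfDeg2 E i (m + i)
    middle≡3 : degree (cycleWithChords n m) (suc m) ≡ 3
    middle≡3 = trans (degree-cycleWithChords 1≤m (n≤1+n (m + m)) (s≤s z≤n) (s≤s (m≤m+n m m)))
                     (cong (2 +_) (degree-chords-upper ≤-refl
                                     (subst (_≤ m + m) (+-comm m 1) (+-monoʳ-≤ m 1≤m))))
    last≡2 : degree (cycleWithChords n m) n ≡ 2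
    last≡2 = trans (degree-cycleWithChords 1≤m (n≤1+n (m + m)) (s≤s z≤n) ≤-refl)
                   (cong (2 +_) (degree-chords-beyond {m} ≤-refl))

record IsAugmentedCycle (n m : ℕ) (E : List Edge) : Set where
  field
    2≤m             : 2 ≤ m
    m+m≤n           : m + m ≤ n
    n≤1+m+m         : n ≤ suc (m + m)
    cycle-edge      : ∀ {i} → 1 ≤ i → i < n → Adj E i (suc i)
    closing-edge    : Adj E 1 n
    chord-edge      : ∀ {j} → 1 ≤ j → j ≤ m → Adj E j (m + j)
    odd-chord-edge  : n ≡ suc (m + m) → Adj E n (suc m)
    neighbours-of-1 : ∀ {w} → Adj E 1 w → w ≡ 2 ⊎ w ≡ n ⊎ w ≡ suc m

data CycleOrChord (n m : ℕ) : Edge → Set where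
  cycle-step : ∀ {i} → 1 ≤ i → CycleOrChord n m (i , suc i)
  closing    : CycleOrChord n m (1 , n)
  chord      : ∀ {j} → 1 ≤ j → CycleOrChord n m (j , m + j)
  odd-chord  : CycleOrChord n m (n , suc m)

cycleWithChords-edge : ∀ {n m e} → e ∈ cycleWithChords n m → CycleOrChord n m e
cycleWithChords-edge {n} {m} e∈ with ∈-++⁻ (cycle n) e∈
... | inj₂ e∈chords with ∈-map⁻ (λ j → (j , m + j)) e∈chords
...   | j , j∈ , refl = chord (proj₁ (∈-oneTo⁻ j∈))
cycleWithChords-edge {n} e∈ | inj₁ e∈cycle with ∈-++⁻ (pathEdges n) e∈cycle
... | inj₂ (here refl) = closing
... | inj₁ e∈path with ∈-map⁻ (λ i → (i , suc i)) e∈path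
...   | i , i∈ , refl = cycle-step (proj₁ (∈-oneTo⁻ i∈))

module _ {n m : ℕ} (2≤n : 2 ≤ n) (2≤m : 2 ≤ m) where

  out-of-1 : ∀ {e} → CycleOrChord n m e → proj₁ e ≡ 1 → proj₂ e ≡ 2 ⊎ proj₂ e ≡ n ⊎ proj₂ e ≡ suc m
  out-of-1 (cycle-step _) refl = inj₁ refl
  out-of-1 closing        refl = inj₂ (inj₁ refl)
  out-of-1 (chord _)      refl = inj₂ (inj₂ (+-comm m 1))
  out-of-1 odd-chord      n≡1  = contradiction n≡1 (>⇒≢ 2≤n)

  not-into-1 : ∀ {e} → CycleOrChord n m e → proj₂ e ≢ 1
  not-into-1 (cycle-step 1≤i) 1+i≡1 = contradiction (suc-injective 1+i≡1) (>⇒≢ 1≤i)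
  not-into-1 closing          n≡1   = >⇒≢ 2≤n n≡1
  not-into-1 (chord 1≤j)      m+j≡1 = >⇒≢ (≤-trans 2≤m (m≤m+n m _)) m+j≡1
  not-into-1 odd-chord        1+m≡1 = contradiction (suc-injective 1+m≡1) (>⇒≢ (≤-trans (s≤s z≤n) 2≤m))

  cycleOrChord-neighbours-of-1 : ∀ {E w} → (∀ {e} → e ∈ E → CycleOrChord n m e) →
                    Adj E 1 w → w ≡ 2 ⊎ w ≡ n ⊎ w ≡ suc m
  cycleOrChord-neighbours-of-1 classify (inj₁ 1w∈E) = out-of-1 (classify 1w∈E) refl
  cycleOrChord-neighbours-of-1 classify (inj₂ w1∈E) = contradiction refl (not-into-1 (classify w1∈E))

∈-pathEdges : ∀ {n i} → 1 ≤ i → i < n → (i , suc i) ∈ pathEdges n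
∈-pathEdges {suc k} 1≤i i<n = ∈-map⁺ (λ i → (i , suc i)) (∈-oneTo⁺ 1≤i (≤-pred i<n))

isAugmentedCycle : ∀ {n m E} → 2 ≤ m → m + m ≤ n → n ≤ suc (m + m) →
  (∀ {e} → e ∈ cycleWithChords n m → e ∈ E) → (n ≡ suc (m + m) → (n , suc m) ∈ E) →
  (∀ {e} → e ∈ E → CycleOrChord n m e) → IsAugmentedCycle n m E
isAugmentedCycle {n} {m} 2≤m m+m≤n n≤1+m+m ⊇cycleWithChords ∋odd-chord classify = record
  { 2≤m             = 2≤m
  ; m+m≤n           = m+m≤n
  ; n≤1+m+m         = n≤1+m+m
  ; cycle-edge      = λ 1≤i i<n → inj₁ (⊇cycleWithChords (∈-++⁺ˡ (∈-++⁺ˡ (∈-pathEdges 1≤i i<n))))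
  ; closing-edge    = inj₁ (⊇cycleWithChords (∈-++⁺ˡ (∈-++⁺ʳ (pathEdges n) (here refl))))
  ; chord-edge      = λ 1≤j j≤m → inj₁ (⊇cycleWithChords (∈-++⁺ʳ (cycle n)
                        (∈-map⁺ (λ j → (j , m + j)) (∈-oneTo⁺ 1≤j j≤m))))
  ; odd-chord-edge  = inj₁ ∘ ∋odd-chord
  ; neighbours-of-1 = cycleOrChord-neighbours-of-1 (≤-trans 2≤m (≤-trans (m≤m+n m m) m+m≤n)) 2≤m classify
  }

⌊n/2⌋-doubled : ∀ n → n ≡ ⌊ n /2⌋ + ⌊ n /2⌋ ⊎ n ≡ suc (⌊ n /2⌋ + ⌊ n /2⌋)
⌊n/2⌋-doubled zero          = inj₁ refl
⌊n/2⌋-doubled (suc zero)    = inj₂ refl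
⌊n/2⌋-doubled (suc (suc n)) with ⌊n/2⌋-doubled n
... | inj₁ even = inj₁ (cong suc (trans (cong suc even) (sym (+-suc ⌊ n /2⌋ ⌊ n /2⌋))))
... | inj₂ odd  = inj₂ (cong suc (trans (cong suc odd) (cong suc (sym (+-suc ⌊ n /2⌋ ⌊ n /2⌋)))))

even-isAugmentedCycle : ∀ {m} → 2 ≤ m → IsAugmentedCycle (m + m) m (pathAugmentation (m + m))
even-isAugmentedCycle {m} 2≤m =
  subst (IsAugmentedCycle (m + m) m) (sym (pathAugmentation-even (≤-trans (s≤s z≤n) 2≤m)))
    (isAugmentedCycle 2≤m ≤-refl (n≤1+n _) id
                      (λ m+m≡1+m+m → contradiction (sym m+m≡1+m+m) (1+n≢n {m + m}))
                      cycleWithChords-edge)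

odd-isAugmentedCycle : ∀ {m} → 2 ≤ m → IsAugmentedCycle (suc (m + m)) m (pathAugmentation (suc (m + m)))
odd-isAugmentedCycle {m} 2≤m =
  subst (IsAugmentedCycle n m) (sym (pathAugmentation-odd (≤-trans (s≤s z≤n) 2≤m)))
    (isAugmentedCycle 2≤m (n≤1+n _) ≤-refl ∈-++⁺ˡ
                      (λ _ → ∈-++⁺ʳ (cycleWithChords n m) (here refl)) classify)
  where
    n : ℕ
    n = suc (m + m)
    classify : ∀ {e} → e ∈ cycleWithChords n m ++ [ (n , suc m) ] → CycleOrChord n m e
    classify e∈ with ∈-++⁻ (cycleWithChords n m) e∈
    ... | inj₁ e∈cycleWithChords = cycleWithChords-edge e∈cycleWithChords
    ... | inj₂ (here refl)       = odd-chord

pathAugmentation-isAugmentedCycle : ∀ {n} → 4 ≤ n → IsAugmentedCycle n ⌊ n /2⌋ (pathAugmentation n)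
pathAugmentation-isAugmentedCycle {n} 4≤n with ⌊n/2⌋-doubled n
... | inj₁ even = subst (λ k → IsAugmentedCycle k ⌊ n /2⌋ (pathAugmentation k)) (sym even)
                        (even-isAugmentedCycle (⌊n/2⌋-mono 4≤n))
... | inj₂ odd  = subst (λ k → IsAugmentedCycle k ⌊ n /2⌋ (pathAugmentation k)) (sym odd)
                        (odd-isAugmentedCycle (⌊n/2⌋-mono 4≤n))

-- Walks in G − S

Reach-antimono : ∀ {n E S S′ u v} → (∀ {w} → w ∈ S → w ∈ S′) → Reach n E S′ u v → Reach n E S u v
Reach-antimono S⊆S′ here                  = here
Reach-antimono S⊆S′ (step adj w∈V w∉S′ r) = step adj w∈V (w∉S′ ∘ S⊆S′) (Reach-antimono S⊆S′ r)

¬Reach-isolated : ∀ {n E S u v} → (∀ {w} → Adj E u w → w ∈ S) → u ≢ v → ¬ Reach n E S u v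
¬Reach-isolated Nᵤ⊆S u≢v here                = u≢v refl
¬Reach-isolated Nᵤ⊆S u≢v (step adj _ w∉S _) = w∉S (Nᵤ⊆S adj)

module Walks {n : ℕ} {E : List Edge} {S : List ℕ} where

  Present : ℕ → Set
  Present w = InV n w × w ∉ S

  _↝_ : ℕ → ℕ → Set
  u ↝ v = Reach n E S u v

  ↝-trans : ∀ {u w v} → u ↝ w → w ↝ v → u ↝ v
  ↝-trans here                  q = q
  ↝-trans (step adj w∈V w∉S r) q = step adj w∈V w∉S (↝-trans r q)

  edge⇒↝ : ∀ {u w} → Adj E u w → Present w → u ↝ w
  edge⇒↝ adj (w∈V , w∉S) = step adj w∈V w∉S here

  ↝-sym : ∀ {u v} → Present u → u ↝ v → v ↝ u
  ↝-sym u-present here                  = here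
  ↝-sym u-present (step adj w∈V w∉S r) = ↝-trans (↝-sym (w∈V , w∉S) r) (edge⇒↝ (swap adj) u-present)

  module Intervals (cycle-edge : ∀ {i} → 1 ≤ i → i < n → Adj E i (suc i)) where

    ascending : ∀ {a b} → a ≤ b → (∀ {w} → a ≤ w → w ≤ b → Present w) → a ↝ b
    ascending {a} {zero}  z≤n   _       = here
    ascending {a} {suc b} a≤1+b present with m≤n⇒m<n∨m≡n a≤1+b
    ... | inj₂ refl      = here
    ... | inj₁ (s≤s a≤b) = ↝-trans (ascending a≤b (λ a≤w w≤b → present a≤w (m≤n⇒m≤1+n w≤b)))
                                   (edge⇒↝ (cycle-edge (proj₁ (proj₁ b-present)) (proj₂ (proj₁ 1+b-present)))
                                           1+b-present)
      where
        b-present : Present b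
        b-present = present a≤b (n≤1+n b)
        1+b-present : Present (suc b)
        1+b-present = present a≤1+b ≤-refl

    interval-connected : ∀ {lo hi} → (∀ {w} → lo < w → w < hi → Present w) →
                         ∀ {u v} → lo < u → u < hi → lo < v → v < hi → u ↝ v
    interval-connected present {u} {v} lo<u u<hi lo<v v<hi with ≤-total u v
    ... | inj₁ u≤v = ascending u≤v (λ u≤w w≤v → present (<-≤-trans lo<u u≤w) (≤-<-trans w≤v v<hi))
    ... | inj₂ v≤u = ↝-sym (present lo<v v<hi)
                           (ascending v≤u (λ v≤w w≤u → present (<-≤-trans lo<v v≤w) (≤-<-trans w≤u u<hi)))

-- Vertex connectivity of an augmented cycle

record Bridge (n : ℕ) (E : List Edge) (x y : ℕ) : Set where
  constructor bridge
  field
    {inner outer}  : ℕ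
    x<inner        : x < inner
    inner<y        : inner < y
    1≤outer        : 1 ≤ outer
    outer≤n        : outer ≤ n
    outer-outside  : outer < x ⊎ y < outer
    edge           : Adj E inner outer

avoid-two : ∀ u v → ∃[ w ] (1 ≤ w × w ≤ 3 × u ≢ w × v ≢ w)
avoid-two u v with u ≟ 1 | v ≟ 1 | u ≟ 2 | v ≟ 2
... | no u≢1   | no v≢1   | _        | _        = 1 , s≤s z≤n , s≤s z≤n , u≢1 , v≢1
... | yes refl | _        | _        | no v≢2   = 2 , s≤s z≤n , s≤s (s≤s z≤n) , (λ ()) , v≢2
... | yes refl | _        | _        | yes refl = 3 , s≤s z≤n , ≤-refl , (λ ()) , (λ ())
... | no _     | yes refl | no u≢2   | _        = 2 , s≤s z≤n , s≤s (s≤s z≤n) , u≢2 , (λ ())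
... | no _     | yes refl | yes refl | _        = 3 , s≤s z≤n , ≤-refl , (λ ()) , (λ ())

module _ {n m E} (aug : IsAugmentedCycle n m E) where
  open IsAugmentedCycle aug

  bridge-down : ∀ {x y} → m ≤ x → suc x < y → y ≤ n → Bridge n E x y
  bridge-down {x} {y} m≤x 1+x<y y≤n with m≤n⇒∃[o]m+o≡n m≤x
  ... | d , refl = bridge (+-monoʳ-< m (n<1+n d)) (subst (_< y) (sym (+-suc m d)) 1+x<y)
                          (s≤s z≤n) (≤-trans 1+d≤m (≤-trans (m≤m+n m m) m+m≤n))
                          (inj₁ (+-monoˡ-≤ d 2≤m)) (swap (chord-edge (s≤s z≤n) 1+d≤m))
    where
      1+d≤m : suc d ≤ m
      1+d≤m = +-cancelˡ-≤ m _ _ (≤-pred (≤-trans (subst (_< y) (sym (+-suc m d)) 1+x<y) (≤-trans y≤n n≤1+m+m)))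

  bridge-up : ∀ {x y} → x < m → suc x < y → y ≤ m + x → Bridge n E x y
  bridge-up {x} {y} x<m 1+x<y y≤m+x =
    bridge (n<1+n x) 1+x<y (≤-trans (s≤s z≤n) (m≤n+m (suc x) m)) (≤-trans (+-monoʳ-≤ m x<m) m+m≤n)
           (inj₂ (≤-<-trans y≤m+x (+-monoʳ-< m (n<1+n x)))) (chord-edge (s≤s z≤n) x<m)

  bridge-back : ∀ {x y} → 1 ≤ x → suc x < m → m + suc x < y → Bridge n E (suc x) y
  bridge-back {x} {y} 1≤x 1+x<m m+1+x<y =
    bridge (+-monoˡ-≤ x 2≤m) (<-trans (+-monoʳ-< m (n<1+n x)) m+1+x<y) 1≤x
           (≤-trans x≤m (≤-trans (m≤m+n m m) m+m≤n)) (inj₁ (n<1+n x)) (swap (chord-edge 1≤x x≤m))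
    where
      x≤m : x ≤ m
      x≤m = ≤-trans (n≤1+n x) (<⇒≤ 1+x<m)

  bridge-from-1 : ∀ {y} → m + 1 < y → y < n → Bridge n E 1 y
  bridge-from-1 {y} m+1<y y<n with y <? m + m
  ... | yes y<m+m with m≤n⇒∃[o]m+o≡n (≤-trans (m≤m+n m 1) (<⇒≤ m+1<y))
  ...   | e , refl =
    bridge {outer = m + suc e} (m<n⇒m<1+n (+-cancelˡ-< m 1 e m+1<y)) (+-monoˡ-≤ e 2≤m)
           (≤-trans (s≤s z≤n) (m≤n+m (suc e) m)) (subst (_≤ n) (sym (+-suc m e)) y<n)
           (inj₂ (+-monoʳ-< m (n<1+n e))) (chord-edge (s≤s z≤n) (+-cancelˡ-< m e m y<m+m))
  bridge-from-1 {y} m+1<y y<n | no y≮m+m =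
    bridge (s≤s (≤-trans (s≤s z≤n) 2≤m)) (≤-trans (+-monoˡ-≤ m 2≤m) m+m≤y) (≤-trans (s≤s z≤n) y<n) ≤-refl
           (inj₂ y<n) (swap (odd-chord-edge (≤-antisym n≤1+m+m (≤-trans (s≤s m+m≤y) y<n))))
    where
      m+m≤y : m + m ≤ y
      m+m≤y = ≮⇒≥ y≮m+m

  find-bridge : ∀ {x y} → 1 ≤ x → suc x < y → y ≤ n → 1 < x ⊎ y < n → Bridge n E x y
  find-bridge {x} {y} 1≤x 1+x<y y≤n nonempty-outside with m ≤? x
  ... | yes m≤x = bridge-down m≤x 1+x<y y≤n
  ... | no m≰x with y ≤? m + x
  ...   | yes y≤m+x = bridge-up (≰⇒> m≰x) 1+x<y y≤m+x
  find-bridge {suc zero}    _ _ _ (inj₁ (s≤s ())) | no _ | no _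
  find-bridge {suc zero}    _ _ _ (inj₂ y<n)      | no _ | no y≰m+1 = bridge-from-1 (≰⇒> y≰m+1) y<n
  find-bridge {suc (suc x)} _ _ _ _ | no m≰x | no y≰m+x = bridge-back (s≤s z≤n) (≰⇒> m≰x) (≰⇒> y≰m+x)

  module Deleting {x y} (1≤x : 1 ≤ x) (x≤y : x ≤ y) (y≤n : y ≤ n) where
    open Walks {n} {E} {x ∷ y ∷ []}
    open Intervals cycle-edge

    present : ∀ {w} → InV n w → w ≢ x → w ≢ y → Present w
    present w∈V w≢x w≢y = w∈V , All¬⇒¬Any (w≢x ∷ w≢y ∷ [])

    below : ∀ {w} → 0 < w → w < x → Present w
    below 0<w w<x = present (0<w , ≤-trans (<⇒≤ w<x) (≤-trans x≤y y≤n)) (<⇒≢ w<x) (<⇒≢ (<-≤-trans w<x x≤y))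

    between : ∀ {w} → x < w → w < y → Present w
    between x<w w<y = present (≤-trans 1≤x (<⇒≤ x<w) , ≤-trans (<⇒≤ w<y) y≤n) (>⇒≢ x<w) (<⇒≢ w<y)

    above : ∀ {w} → y < w → w < suc n → Present w
    above y<w w<1+n = present (≤-trans (s≤s z≤n) y<w , ≤-pred w<1+n) (>⇒≢ (≤-<-trans x≤y y<w)) (>⇒≢ y<w)

    Outside : ℕ → Set
    Outside w = InV n w × (w < x ⊎ y < w)

    Between : ℕ → Set
    Between w = x < w × w < y

    outside-present : ∀ {w} → Outside w → Present w
    outside-present (w∈V , inj₁ w<x) = below (proj₁ w∈V) w<x
    outside-present (w∈V , inj₂ y<w) = above y<w (s≤s (proj₂ w∈V))

    region : ∀ {w} → InV n w → w ∉ x ∷ y ∷ [] → Between w ⊎ Outside w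
    region {w} w∈V w∉S with <-cmp w x
    ... | tri< w<x _ _ = inj₂ (w∈V , inj₁ w<x)
    ... | tri≈ _ w≡x _ = contradiction (here w≡x) w∉S
    ... | tri> _ _ x<w with <-cmp w y
    ...   | tri< w<y _ _ = inj₁ (x<w , w<y)
    ...   | tri≈ _ w≡y _ = contradiction (there (here w≡y)) w∉S
    ...   | tri> _ _ y<w = inj₂ (w∈V , inj₂ y<w)

    outside-connected : ∀ {u v} → Outside u → Outside v → u ↝ v
    outside-connected ((0<u , _) , inj₁ u<x) ((0<v , _) , inj₁ v<x) = interval-connected below 0<u u<x 0<v v<x
    outside-connected ((_ , u≤n) , inj₂ y<u) ((_ , v≤n) , inj₂ y<v) =
      interval-connected above y<u (s≤s u≤n) y<v (s≤s v≤n)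
    outside-connected ((0<u , _) , inj₁ u<x) ((_ , v≤n) , inj₂ y<v) =
      ↝-trans (interval-connected below 0<u u<x ≤-refl (≤-<-trans 0<u u<x))
        (↝-trans (edge⇒↝ closing-edge (above y<n ≤-refl))
                 (interval-connected above y<n ≤-refl y<v (s≤s v≤n)))
      where
        y<n : y < n
        y<n = <-≤-trans y<v v≤n
    outside-connected u-outside@(_ , inj₂ _) v-outside@(_ , inj₁ _) =
      ↝-sym (outside-present v-outside) (outside-connected v-outside u-outside)

    between-to-outside : ∀ {u v} → Between u → Outside v → u ↝ v
    between-to-outside {u} {v} (x<u , u<y) v-outside@(v∈V , v-side)
      with find-bridge 1≤x (≤-<-trans x<u u<y) y≤n (nonempty v-side)
      where
        nonempty : v < x ⊎ y < v → 1 < x ⊎ y < n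
        nonempty (inj₁ v<x) = inj₁ (≤-<-trans (proj₁ v∈V) v<x)
        nonempty (inj₂ y<v) = inj₂ (<-≤-trans y<v (proj₂ v∈V))
    ... | bridge x<i i<y 1≤o o≤n o-side edge =
      ↝-trans (interval-connected between x<u u<y x<i i<y)
        (↝-trans (edge⇒↝ edge (outside-present ((1≤o , o≤n) , o-side)))
                 (outside-connected ((1≤o , o≤n) , o-side) v-outside))

    connect : ∀ {u v} → Between u ⊎ Outside u → Between v ⊎ Outside v → u ↝ v
    connect (inj₁ (x<u , u<y))   (inj₁ (x<v , v<y)) = interval-connected between x<u u<y x<v v<y
    connect (inj₁ u-between)     (inj₂ v-outside)   = between-to-outside u-between v-outside
    connect (inj₂ u-outside)     (inj₁ (x<v , v<y)) =
      ↝-sym (between x<v v<y) (between-to-outside (x<v , v<y) u-outside)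
    connect (inj₂ u-outside)     (inj₂ v-outside)   = outside-connected u-outside v-outside

  connected-minus-ordered : ∀ {x y} → 1 ≤ x → x ≤ y → y ≤ n → ConnectedMinus n E (x ∷ y ∷ [])
  connected-minus-ordered 1≤x x≤y y≤n u v u∈V v∈V u∉S v∉S = connect (region u∈V u∉S) (region v∈V v∉S)
    where open Deleting 1≤x x≤y y≤n

  connected-minus-pair : ∀ {x y} → InV n x → InV n y → ConnectedMinus n E (x ∷ y ∷ [])
  connected-minus-pair {x} {y} (1≤x , x≤n) (1≤y , y≤n) with ≤-total x y
  ... | inj₁ x≤y = connected-minus-ordered 1≤x x≤y y≤n
  ... | inj₂ y≤x = λ u v u∈V v∈V u∉S v∉S →
    Reach-antimono swap-∈
      (connected-minus-ordered 1≤y y≤x x≤n u v u∈V v∈V (u∉S ∘ swap-∈) (v∉S ∘ swap-∈))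
    where
      swap-∈ : ∀ {w a b} → w ∈ a ∷ b ∷ [] → w ∈ b ∷ a ∷ []
      swap-∈ (here w≡a)         = there (here w≡a)
      swap-∈ (there (here w≡b)) = here w≡b

  3-connected : 4 ≤ n → KConnected n E 3
  3-connected 4≤n = 4≤n , connected-minus
    where
      connected-minus : ∀ S → Unique S → (∀ x → x ∈ S → InV n x) → length S < 3 → ConnectedMinus n E S
      connected-minus [] _ _ _ u v u∈V v∈V _ _ with avoid-two u v
      ... | w , 1≤w , w≤3 , u≢w , v≢w =
        Reach-antimono (λ ()) (connected-minus-pair w∈V w∈V u v u∈V v∈V
                                 (All¬⇒¬Any (u≢w ∷ u≢w ∷ [])) (All¬⇒¬Any (v≢w ∷ v≢w ∷ [])))
        where
          w∈V : InV n w
          w∈V = 1≤w , ≤-trans w≤3 (≤-trans (n≤1+n 3) 4≤n)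
      connected-minus (x ∷ []) _ S⊆V _ u v u∈V v∈V u∉S v∉S =
        Reach-antimono there (connected-minus-pair x∈V x∈V u v u∈V v∈V
                               (All¬⇒¬Any (u∉S ∘ here ∷ u∉S ∘ here ∷ []))
                               (All¬⇒¬Any (v∉S ∘ here ∷ v∉S ∘ here ∷ [])))
        where
          x∈V : InV n x
          x∈V = S⊆V x (here refl)
      connected-minus (x ∷ y ∷ []) _ S⊆V _ = connected-minus-pair (S⊆V x (here refl)) (S⊆V y (there (here refl)))
      connected-minus (_ ∷ _ ∷ _ ∷ _) _ _ (s≤s (s≤s (s≤s ())))

  not-4-connected : ¬ KConnected n E 4
  not-4-connected (4<n , connected-minus) =
    ¬Reach-isolated N₁⊆S (λ ())
      (connected-minus S S-unique S⊆V (s≤s (s≤s (s≤s (s≤s z≤n)))) 1 (2 + m) (≤-refl , 1≤n) (s≤s z≤n , 2+m≤n)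
        (All¬⇒¬Any ((λ ()) ∷ <⇒≢ (≤-trans (s≤s (s≤s z≤n)) 4<n) ∷ <⇒≢ 1<1+m ∷ []))
        (All¬⇒¬Any (>⇒≢ (s≤s 1<1+m) ∷ 2+m≢n ∷ 1+n≢n ∷ [])))
    where
      S : List ℕ
      S = 2 ∷ n ∷ suc m ∷ []
      1<1+m : 1 < suc m
      1<1+m = s≤s (≤-trans (s≤s z≤n) 2≤m)
      2+m≤n : 2 + m ≤ n
      2+m≤n = ≤-trans (+-monoˡ-≤ m 2≤m) m+m≤n
      1≤n : 1 ≤ n
      1≤n = ≤-trans (s≤s z≤n) 4<n
      2+m≢n : 2 + m ≢ n
      2+m≢n 2+m≡n = <-irrefl refl (≤-trans (+-monoˡ-≤ m 3≤m) (subst (m + m ≤_) (sym 2+m≡n) m+m≤n))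
        where
          3≤m : 3 ≤ m
          3≤m = ≤-pred (≤-pred (subst (5 ≤_) (sym 2+m≡n) 4<n))
      S-unique : Unique S
      S-unique = (<⇒≢ (≤-trans (s≤s (s≤s (s≤s z≤n))) 4<n) ∷ <⇒≢ (s≤s 2≤m) ∷ [])
               ∷ (>⇒≢ 2+m≤n ∷ []) ∷ [] ∷ []
      S⊆V : ∀ x → x ∈ S → InV n x
      S⊆V _ (here refl)                 = s≤s z≤n , ≤-trans (s≤s (s≤s z≤n)) 4<n
      S⊆V _ (there (here refl))         = 1≤n , ≤-refl
      S⊆V _ (there (there (here refl))) = s≤s z≤n , ≤-trans (n≤1+n _) 2+m≤n
      N₁⊆S : ∀ {w} → Adj E 1 w → w ∈ S
      N₁⊆S adj with neighbours-of-1 adj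
      ... | inj₁ refl               = here refl
      ... | inj₂ (inj₁ refl)        = there (here refl)
      ... | inj₂ (inj₂ refl)        = there (there (here refl))

lemma6 : (n : ℕ) → 4 ≤ n → VertexConnectivityIs n (pathAugmentation n) 3
lemma6 n 4≤n = 3-connected aug 4≤n , not-4-connected aug
  where
    aug : IsAugmentedCycle n ⌊ n /2⌋ (pathAugmentation n)
    aug = pathAugmentation-isAugmentedCycle 4≤n
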